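{- Let $F$ be a good filter on $\omega$, as witnessed by $f,\pi:\omega\to\omega$ (and some $T$), and let $g:\omega\to\omega$ be any function. Let $B=\{n<\omega\mid g(\pi(n))<f(n)\}$. Then $F[B]$, the filter generated by $F\cup\{B\}$, is a (proper) good filter, witnessed by $f,\pi$ (and $T$).
   Context: For $T\subseteq\mathcal{P}(\omega)$, $\diamondsuit^*(F,\pi,f,T)$ means there is $\langle\mathcal{A}_n\mid n<\omega\rangle$ with $\mathcal{A}_n\subseteq\mathcal{P}(f(n))$ (where $f(n)=\{0,\dots,f(n)-1\}$), $|\mathcal{A}_n|\le\pi(n)$, and $\{n\mid X\cap f(n)\in\mathcal{A}_n\}\in F$ for every $X\in T$. A set is $F$-positive if it meets every member of $F$. $F$ is good, witnessed by $f,\pi,T$, if $T\subseteq\mathcal{P}(\omega)$, $|T|=\mathfrak{c}$, $\diamondsuit^*(F,\pi,f,T)$ holds, and for every $g:\omega\to\omega$ the set $\{n\mid g(\pi(n))<f(n)\}$ is $F$-positive. -}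

module Defs where

open import Data.Nat using (ℕ; _<_)
open import Data.Bool using (Bool; true; false; T)
open import Data.Fin using (Fin; toℕ)
open import Data.Vec using (Vec; tabulate)
open import Data.List using (List; length)
open import Data.Product using (Σ; ∃; _×_; _,_)
open import Relation.Nullary using (¬_)
open import Relation.Binary.PropositionalEquality using (_≡_)
open import Relation.Nullary.Decidable using (⌊_⌋)
open import Data.Nat using (_≤_; _<ᵇ_)
open import Data.Bool using (_∧_)
open import Data.Vec.Properties using (≡-dec)
import Data.List.Membership.DecPropositional as DecMem

Subset : Set
Subset = ℕ → Bool

_∈ˢ_ : ℕ → Subset → Set
n ∈ˢ X = T (X n)

_⊆ˢ_ : Subset → Subset → Set
X ⊆ˢ Y = ∀ n → n ∈ˢ X → n ∈ˢ Y

_≈ˢ_ : Subset → Subset → Set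
X ≈ˢ Y = ∀ n → X n ≡ Y n

_∩ˢ_ : Subset → Subset → Subset
(X ∩ˢ Y) n = X n ∧ Y n

fullˢ : Subset
fullˢ _ = true

emptyˢ : Subset
emptyˢ _ = false

Family : Set₁
Family = Subset → Set

record IsFilter (F : Family) : Set where
  field
    full∈   : F fullˢ
    upward  : ∀ {X Y} → F X → X ⊆ˢ Y → F Y
    inter   : ∀ {X Y} → F X → F Y → F (X ∩ˢ Y)
    proper  : ¬ F emptyˢ

Positive : Family → Subset → Set
Positive F A = ∀ X → F X → Σ ℕ λ n → n ∈ˢ X × n ∈ˢ A

BelowSet : (g π f : ℕ → ℕ) → Subset
BelowSet g π f n = g (π n) <ᵇ f n

-- X ∩ f(n) = X ∩ {0,…,f(n)-1}, as a finite subset of Fin (f n).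
restrict : Subset → (k : ℕ) → Vec Bool k
restrict X k = tabulate (λ i → X (toℕ i))

-- ◇*(F, π, f, T): there are 𝒜ₙ ⊆ 𝒫(f(n)) with |𝒜ₙ| ≤ π(n) such that
-- {n | X ∩ f(n) ∈ 𝒜ₙ} ∈ F for every X ∈ T.
-- 𝒜ₙ is given as a finite list (repetitions allowed) of subsets of f(n).
memberSet : (f : ℕ → ℕ) → ((n : ℕ) → List (Vec Bool (f n))) → Subset → Subset
memberSet f 𝒜 X n = ⌊ DecMem._∈?_ (≡-dec {n = f n} Data.Bool._≟_) (restrict X (f n)) (𝒜 n) ⌋

Diamond* : Family → (π f : ℕ → ℕ) → Family → Set
Diamond* F π f Tf =
  Σ ((n : ℕ) → List (Vec Bool (f n))) λ 𝒜 →
    ((n : ℕ) → length (𝒜 n) ≤ π n) ×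
    (∀ X → Tf X → F (memberSet f 𝒜 X))

-- |T| = 𝔠 for T ⊆ 𝒫(ω): (|T| ≤ 𝔠 is automatic) there is an injection of
-- 𝒫(ω) into T (injective w.r.t. extensional equality of subsets).
HasSizeContinuum : Family → Set
HasSizeContinuum Tf =
  Σ (Subset → Subset) λ h →
    (∀ X → Tf (h X)) × (∀ X Y → h X ≈ˢ h Y → X ≈ˢ Y)

IsGood : Family → (f π : ℕ → ℕ) → Family → Set
IsGood F f π Tf =
  HasSizeContinuum Tf × Diamond* F π f Tf ×
  (∀ (g : ℕ → ℕ) → Positive F (BelowSet g π f))

Generated : Family → Subset → Family
Generated F B Y = Σ Subset λ A → F A × (A ∩ˢ B) ⊆ˢ Y

-- F[B] is proper because B is F-positive (goodness applied to g itself), and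
-- the ◇* sequence of F serves F[B] ⊇ F unchanged. A set C is F[B]-positive as
-- soon as B ∩ C is F-positive; for C = {n | g′(π n) < f n} this follows from
-- goodness applied to max(g, g′), whose set of n lies inside B ∩ C.
module Submission where

open import Defs
open import Data.Nat using (ℕ; _⊔_; _<_)
open import Data.Nat.Properties using (<ᵇ⇒<; <⇒<ᵇ; m≤m⊔n; m≤n⊔m; ≤-<-trans)
open import Data.Bool.Properties using (T-∧)
open import Data.Product using (_×_; _,_; proj₁)
open import Function.Bundles using (Equivalence)
open import Relation.Nullary using (¬_)

∈-∩⁺ : ∀ X Y {n} → n ∈ˢ X → n ∈ˢ Y → n ∈ˢ (X ∩ˢ Y)
∈-∩⁺ X Y {n} x y = Equivalence.from (T-∧ {X n} {Y n}) (x , y)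

∈-∩⁻ : ∀ X Y {n} → n ∈ˢ (X ∩ˢ Y) → n ∈ˢ X × n ∈ˢ Y
∈-∩⁻ X Y {n} = Equivalence.to (T-∧ {X n} {Y n})

Positive-mono : ∀ {F A A′} → A ⊆ˢ A′ → Positive F A → Positive F A′
Positive-mono A⊆A′ pos X FX with pos X FX
... | n , n∈X , n∈A = n , n∈X , A⊆A′ n n∈A

module _ {F : Family} (B : Subset) where

  ⊆-Generated : ∀ {X} → F X → Generated F B X
  ⊆-Generated {X} FX = X , FX , λ n p → proj₁ (∈-∩⁻ X B p)

  Generated-isFilter : IsFilter F → Positive F B → IsFilter (Generated F B)
  Generated-isFilter isF posB = record
    { full∈  = ⊆-Generated full∈
    ; upward = λ { (A , FA , A∩B⊆X) X⊆Y → A , FA , λ n p → X⊆Y n (A∩B⊆X n p) }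
    ; inter  = λ { (A₁ , FA₁ , s₁) (A₂ , FA₂ , s₂) →
                   A₁ ∩ˢ A₂ , inter FA₁ FA₂ , λ n p → ∩-closed A₁ A₂ s₁ s₂ p }
    ; proper = λ { (A , FA , A∩B⊆∅) → A∩B-inhabited A FA A∩B⊆∅ }
    }
    where
    open IsFilter isF
    ∩-closed : ∀ {Y₁ Y₂ n} A₁ A₂ → (A₁ ∩ˢ B) ⊆ˢ Y₁ → (A₂ ∩ˢ B) ⊆ˢ Y₂ →
           n ∈ˢ ((A₁ ∩ˢ A₂) ∩ˢ B) → n ∈ˢ (Y₁ ∩ˢ Y₂)
    ∩-closed {Y₁} {Y₂} {n} A₁ A₂ s₁ s₂ p
      with ∈-∩⁻ (A₁ ∩ˢ A₂) B p
    ... | a , b with ∈-∩⁻ A₁ A₂ a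
    ... | a₁ , a₂ = ∈-∩⁺ Y₁ Y₂ (s₁ n (∈-∩⁺ A₁ B a₁ b)) (s₂ n (∈-∩⁺ A₂ B a₂ b))
    A∩B-inhabited : ∀ A → F A → ¬ ((A ∩ˢ B) ⊆ˢ emptyˢ)
    A∩B-inhabited A FA A∩B⊆∅ with posB A FA
    ... | n , n∈A , n∈B = A∩B⊆∅ n (∈-∩⁺ A B n∈A n∈B)

  Positive-Generated : ∀ {C} → Positive F (B ∩ˢ C) → Positive (Generated F B) C
  Positive-Generated {C} pos Y (A , FA , A∩B⊆Y) with pos A FA
  ... | n , n∈A , n∈B∩C with ∈-∩⁻ B C n∈B∩C
  ... | n∈B , n∈C = n , A∩B⊆Y n (∈-∩⁺ A B n∈A n∈B) , n∈C

Diamond*-mono : ∀ {F G π f Tf} → (∀ {X} → F X → G X) →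
                Diamond* F π f Tf → Diamond* G π f Tf
Diamond*-mono F⊆G (𝒜 , |𝒜|≤π , F∋member) = 𝒜 , |𝒜|≤π , λ X TX → F⊆G (F∋member X TX)

BelowSet-⊔ : ∀ g g′ π f →
             BelowSet (λ k → g k ⊔ g′ k) π f ⊆ˢ (BelowSet g π f ∩ˢ BelowSet g′ π f)
BelowSet-⊔ g g′ π f n below =
  ∈-∩⁺ (BelowSet g π f) (BelowSet g′ π f)
       (<⇒<ᵇ (≤-<-trans (m≤m⊔n (g (π n)) (g′ (π n))) max<f))
       (<⇒<ᵇ (≤-<-trans (m≤n⊔m (g (π n)) (g′ (π n))) max<f))
  where
  max<f : g (π n) ⊔ g′ (π n) < f n
  max<f = <ᵇ⇒< (g (π n) ⊔ g′ (π n)) (f n) below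

mainTheorem13 : (F : Family) (f π : ℕ → ℕ) (Tf : Family) →
    IsFilter F → IsGood F f π Tf → (g : ℕ → ℕ) →
    IsFilter (Generated F (BelowSet g π f)) ×
    IsGood (Generated F (BelowSet g π f)) f π Tf
mainTheorem13 F f π Tf isF (|Tf|≡𝔠 , ◇* , positive) g =
  Generated-isFilter B isF (positive g) ,
  |Tf|≡𝔠 ,
  Diamond*-mono {G = Generated F B} (⊆-Generated B) ◇* ,
  λ g′ → Positive-Generated B
           (Positive-mono (BelowSet-⊔ g g′ π f) (positive (λ k → g k ⊔ g′ k)))
  where B = BelowSet g π f
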